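{- Let $n$ be a composite positive integer, let $q$ be the smallest prime dividing $n$ and $p$ the smallest prime dividing $n/q$. Then the number of generalized wreath circulant graphs of order $n$ is at most $(\log_2^2 n)\,2^{n(p+q-1)/(2pq)+1/2}$; in particular it is at most $(\log_2^2 n)\,2^{3n/8+1/2}$.
   Context: A circulant graph of order $n$ is $\Gamma(\mathbb{Z}_n,S)$ with vertex set $\mathbb{Z}_n$, arcs $\{(u,v):u-v\in S\}$, where $S\subseteq\mathbb{Z}_n\setminus\{0\}$ and $S=-S$, counted as labelled objects (by $S$). It is a generalized wreath circulant graph if there are subgroups $\{0\}\ne K\le H\ne\mathbb{Z}_n$ of $\mathbb{Z}_n$ with $S\setminus H$ a union of cosets of $K$. $\log_2^2 n$ denotes $(\log_2 n)^2$. -}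

module Defs where

open import Data.Nat using (ℕ; zero; suc; _+_; _*_; _∸_; _^_; _≤_; _<_)
open import Data.Nat.DivMod using (_%_; m%n<n)
open import Data.Fin using (Fin; toℕ; fromℕ<)
open import Data.Fin.Subset using (Subset; _∈_; _∉_)
open import Data.Product using (Σ; ∃; _×_)
open import Relation.Nullary using (¬_)
open import Relation.Binary.PropositionalEquality using (_≡_; _≢_)

_⊕_ : ∀ {n} → Fin n → Fin n → Fin n
_⊕_ {suc m} i j = fromℕ< (m%n<n (toℕ i + toℕ j) (suc m))

⊖_ : ∀ {n} → Fin n → Fin n
⊖_ {suc m} i = fromℕ< (m%n<n (suc m ∸ toℕ i) (suc m))

record IsSubgroup {n : ℕ} (H : Subset n) : Set where
  field
    has-zero : ∀ x → toℕ x ≡ 0 → x ∈ H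
    closed-⊕ : ∀ x y → x ∈ H → y ∈ H → (x ⊕ y) ∈ H
    closed-⊖ : ∀ x → x ∈ H → (⊖ x) ∈ H

record IsConnectionSet {n : ℕ} (S : Subset n) : Set where
  field
    no-zero   : ∀ x → toℕ x ≡ 0 → x ∉ S
    symmetric : ∀ x → x ∈ S → (⊖ x) ∈ S

UnionOfCosetsOutside : ∀ {n} → Subset n → Subset n → Subset n → Set
UnionOfCosetsOutside S H K =
  ∀ x k → x ∈ S → x ∉ H → k ∈ K → ((x ⊕ k) ∈ S × (x ⊕ k) ∉ H)

record GWWitness {n : ℕ} (S : Subset n) (K H : Subset n) : Set where
  field
    K-subgroup  : IsSubgroup K
    H-subgroup  : IsSubgroup H
    K-nontrivial : ∃ λ x → x ∈ K × toℕ x ≢ 0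
    K≤H         : ∀ x → x ∈ K → x ∈ H
    H-proper    : ∃ λ x → x ∉ H
    cosets      : UnionOfCosetsOutside S H K

IsGenWreathCirculant : ∀ {n} → Subset n → Set
IsGenWreathCirculant {n} S =
  IsConnectionSet S × Σ (Subset n) λ K → Σ (Subset n) λ H → GWWitness S K H

-- BoundLog c e d n  expresses the real inequality
--      c ≤ (log₂ n)² · 2^(e/d)        (for d > 0, n ≥ 1)
-- using naturals only.  With r = (c^d / 2^e)^(1/(2d)) the inequality is
-- r ≤ log₂ n, i.e. every rational a/b ≥ 0 with (a/b)^(2d) < c^d/2^e satisfies
-- a/b ≤ log₂ n, i.e. 2^a ≤ n^b.
BoundLog : ℕ → ℕ → ℕ → ℕ → Set
BoundLog c e d n =
  ∀ a b → 0 < b → a ^ (2 * d) * 2 ^ e < c ^ d * b ^ (2 * d) → 2 ^ a ≤ n ^ b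

-- A generalized wreath connection set S, with witnesses K ≤ H, is "adapted" to a pair
-- of primes (r , s) dividing N: K contains the subgroup of order r and H lies in sℤ_N,
-- so S is invariant under translation by N/r away from sℤ_N. Writing N = r s t, this
-- invariance together with S = −S determines S by its values at κ = ⌊st/2⌋ + ⌊rt/2⌋ − ⌊t/2⌋
-- positions, so each of the at most (log₂ N)² pairs accounts for at most 2^κ sets.
-- Since r and s dominate q and p in some order, κ ≤ N(p+q−1)/(2pq) + 1/2 ≤ 3N/8 + 1/2.

module Submission where

open import Defs
open import Data.Bool using (Bool; true; false)
import Data.Bool as Bool
open import Data.Bool.Properties using (¬-not; ⇔→≡)
open import Data.Empty using (⊥-elim)
open import Data.Fin using (Fin; toℕ; fromℕ<)
open import Data.Fin.Properties using (toℕ-fromℕ<; toℕ<n; toℕ-injective; all?)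
open import Data.Fin.Subset using (Subset; _∈_; _∉_)
open import Data.Fin.Subset.Properties using (_∈?_)
open import Data.List using (List; []; _∷_; _++_; length; map; filter; applyUpTo; cartesianProduct)
open import Data.List.Properties using (length-++; length-map; length-applyUpTo; filter-none)
open import Data.List.Membership.Propositional using () renaming (_∈_ to _∈ₗ_)
open import Data.List.Membership.Propositional.Properties
  using (∈-++⁺ˡ; ∈-++⁺ʳ; ∈-applyUpTo⁺; ∈-filter⁻; ∈-cartesianProduct⁺; ∈-cartesianProduct⁻)
open import Data.List.Relation.Unary.All as All using (All; []; _∷_)
import Data.List.Relation.Unary.All.Properties as AllP
open import Data.List.Relation.Unary.Any using (here; there)
open import Data.List.Relation.Unary.AllPairs using (_∷_)
open import Data.List.Relation.Unary.Unique.Propositional using (Unique)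
import Data.List.Relation.Unary.Unique.Propositional.Properties as Unique
open import Data.Nat
  using (ℕ; zero; suc; pred; _+_; _*_; _∸_; _^_; _≤_; _<_; _≤?_; _<?_; _≟_; z≤n; s≤s; s≤s⁻¹; z<s; ⌊_/2⌋; ⌈_/2⌉;
         NonZero; >-nonZero; >-nonZero⁻¹; nonTrivial⇒n>1)
open import Data.Nat.Properties
open import Data.Nat.DivMod
open import Data.Nat.Divisibility
open import Data.Nat.ListAction using (sum; product)
open import Data.Nat.Primality
  using (Prime; Composite; euclidsLemma; prime⇒nonZero; prime⇒nonTrivial; composite⇒nonTrivial; ¬composite[0])
open import Data.Nat.Primality.Factorisation using (PrimeFactorisation; factorise; factorisationHasAllPrimeFactors)
open import Data.Nat.Solver using (module +-*-Solver)
open import Data.Product using (∃; ∃₂; _×_; _,_; proj₁; proj₂)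
open import Data.Sum using (_⊎_; inj₁; inj₂)
open import Data.Vec using (lookup)
open import Data.Vec.Properties using ([]=⇒lookup; lookup⇒[]=; tabulate∘lookup; tabulate-cong)
open import Function using (_∘_)
open import Function.Bundles using (mk⇔)
open import Level using (0ℓ)
open import Relation.Binary.PropositionalEquality
open import Relation.Nullary using (¬_; Dec; yes; no; ¬?)
open import Relation.Nullary.Decidable using (_×-dec_; _→-dec_; map′)
open import Relation.Unary using (Pred; Decidable)
open import Relation.Unary.Properties using (∁?)

open +-*-Solver using (solve; _:+_; _:*_; _:=_; con)

⌊n/2⌋+⌊n/2⌋≤n : ∀ n → ⌊ n /2⌋ + ⌊ n /2⌋ ≤ n
⌊n/2⌋+⌊n/2⌋≤n n = ≤-trans (+-monoʳ-≤ ⌊ n /2⌋ (⌊n/2⌋≤⌈n/2⌉ n)) (≤-reflexive (⌊n/2⌋+⌈n/2⌉≡n n))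

n≤1+⌊n/2⌋+⌊n/2⌋ : ∀ n → n ≤ suc (⌊ n /2⌋ + ⌊ n /2⌋)
n≤1+⌊n/2⌋+⌊n/2⌋ n = begin
  n                       ≡⟨ ⌊n/2⌋+⌈n/2⌉≡n n ⟨
  ⌊ n /2⌋ + ⌈ n /2⌉       ≤⟨ +-monoʳ-≤ ⌊ n /2⌋ (⌊n/2⌋-mono (n≤1+n (suc n))) ⟩
  ⌊ n /2⌋ + suc ⌊ n /2⌋   ≡⟨ +-suc ⌊ n /2⌋ ⌊ n /2⌋ ⟩
  suc (⌊ n /2⌋ + ⌊ n /2⌋) ∎
  where open ≤-Reasoning

m+m≤n⇒m≤⌊n/2⌋ : ∀ {m n} → m + m ≤ n → m ≤ ⌊ n /2⌋
m+m≤n⇒m≤⌊n/2⌋ {m} m+m≤n = ≤-trans (≤-reflexive (n≡⌊n+n/2⌋ m)) (⌊n/2⌋-mono m+m≤n)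

n<m+m⇒⌊n/2⌋<m : ∀ {m n} → n < m + m → ⌊ n /2⌋ < m
n<m+m⇒⌊n/2⌋<m {m} {n} n<m+m =
  ≰⇒> λ m≤⌊n/2⌋ → <⇒≱ n<m+m (≤-trans (+-mono-≤ m≤⌊n/2⌋ m≤⌊n/2⌋) (⌊n/2⌋+⌊n/2⌋≤n n))

m≤n+n⇒[m∸n]+[m∸n]≤m : ∀ {m n} → m ≤ n + n → n ≤ m → (m ∸ n) + (m ∸ n) ≤ m
m≤n+n⇒[m∸n]+[m∸n]≤m {m} {n} m≤n+n n≤m = begin
  (m ∸ n) + (m ∸ n) ≤⟨ +-monoʳ-≤ (m ∸ n) (m≤n+o⇒m∸n≤o m n m≤n+n) ⟩
  (m ∸ n) + n       ≡⟨ m∸n+n≡m n≤m ⟩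
  m                 ∎
  where open ≤-Reasoning

∣m∣n⇒∣m∸n : ∀ {d m n} → d ∣ m → d ∣ n → d ∣ m ∸ n
∣m∣n⇒∣m∸n {d} {m} {n} d∣m d∣n with n ≤? m
... | yes n≤m = ∣m+n∣m⇒∣n (subst (d ∣_) (sym (m+[n∸m]≡n n≤m)) d∣m) d∣n
... | no n≰m = subst (d ∣_) (sym (m≤n⇒m∸n≡0 (<⇒≤ (≰⇒> n≰m)))) (d ∣0)

m*n≤o⇒m≤o/n : ∀ m n o .{{_ : NonZero n}} → m * n ≤ o → m ≤ o / n
m*n≤o⇒m≤o/n m n o m*n≤o = subst (_≤ o / n) (m*n/n≡m m n) (/-monoˡ-≤ n m*n≤o)

[m*n]^k≡m^k*n^k : ∀ m n k → (m * n) ^ k ≡ m ^ k * n ^ k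
[m*n]^k≡m^k*n^k m n zero = refl
[m*n]^k≡m^k*n^k m n (suc k) = begin
  m * n * (m * n) ^ k      ≡⟨ cong (m * n *_) ([m*n]^k≡m^k*n^k m n k) ⟩
  m * n * (m ^ k * n ^ k)  ≡⟨ solve 4 (λ m n x y → m :* n :* (x :* y) := m :* x :* (n :* y)) refl m n (m ^ k) (n ^ k) ⟩
  m * m ^ k * (n * n ^ k)  ∎
  where open ≡-Reasoning

m^k<n^k⇒m<n : ∀ {m n} k → m ^ k < n ^ k → m < n
m^k<n^k⇒m<n k m^k<n^k = ≰⇒> λ n≤m → <⇒≱ m^k<n^k (^-monoˡ-≤ k n≤m)

least-or-none : (P : ℕ → Set) → (∀ k → Dec (P k)) → ∀ B →
  (∀ k → k < B → ¬ P k) ⊎ (∃ λ k → k < B × P k × (∀ j → j < k → ¬ P j))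
least-or-none P P? zero = inj₁ (λ _ ())
least-or-none P P? (suc B) with least-or-none P P? B
... | inj₂ (k , k<B , Pk , least) = inj₂ (k , m<n⇒m<1+n k<B , Pk , least)
... | inj₁ none with P? B
...   | yes PB = inj₂ (B , ≤-refl , PB , none)
...   | no ¬PB = inj₁ none≤B
  where
  none≤B : ∀ k → k < suc B → ¬ P k
  none≤B k k<1+B with m≤n⇒m<n∨m≡n (s≤s⁻¹ k<1+B)
  ... | inj₁ k<B = none k k<B
  ... | inj₂ refl = ¬PB

prime⇒1< : ∀ {p} → Prime p → 1 < p
prime⇒1< {p} p-prime = nonTrivial⇒n>1 p {{prime⇒nonTrivial p-prime}}

∃-prime-divisor : ∀ n → 1 < n → ∃ λ p → Prime p × p ∣ n
∃-prime-divisor n 1<n with factorise n {{>-nonZero (<-trans z<s 1<n)}}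
... | record { factors = [] ; isFactorisation = n≡1 } = ⊥-elim (<-irrefl (sym n≡1) 1<n)
... | record { factors = p ∷ ps ; isFactorisation = n≡p*ps ; factorsPrime = p-prime ∷ _ } =
  p , p-prime , divides (product ps) (trans n≡p*ps (*-comm p (product ps)))

2^length≤product : ∀ ps → All Prime ps → 2 ^ length ps ≤ product ps
2^length≤product [] [] = ≤-refl
2^length≤product (p ∷ ps) (p-prime ∷ ps-prime) = *-mono-≤ (prime⇒1< p-prime) (2^length≤product ps ps-prime)

least-prime-factors-dominate : ∀ {n q m p r s t} → Prime q → n ≡ q * m →
  (∀ r → Prime r → r ∣ n → q ≤ r) → (∀ r → Prime r → r ∣ m → p ≤ r) →
  Prime r → Prime s → n ≡ r * s * t → (q ≤ r × p ≤ s) ⊎ (q ≤ s × p ≤ r)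
least-prime-factors-dominate {n} {q} {m} {p} {r} {s} {t} q-prime n≡qm q-least p-least r-prime s-prime n≡rst =
  by-cases (euclidsLemma q m r-prime (subst (r ∣_) n≡qm r∣n))
  where
  instance
    q-nonZero : NonZero q
    q-nonZero = prime⇒nonZero q-prime
  r∣n : r ∣ n
  r∣n = subst (r ∣_) (sym n≡rst) (∣m⇒∣m*n t (m∣m*n s))
  s∣n : s ∣ n
  s∣n = subst (s ∣_) (sym n≡rst) (n∣m*n*o r t)
  by-cases : r ∣ q ⊎ r ∣ m → (q ≤ r × p ≤ s) ⊎ (q ≤ s × p ≤ r)
  by-cases (inj₂ r∣m) = inj₂ (q-least s s-prime s∣n , p-least r r-prime r∣m)
  by-cases (inj₁ r∣q) = inj₁ (q≤r , p-least s s-prime (divides t (trans m≡st (*-comm s t))))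
    where
    q≤r : q ≤ r
    q≤r = q-least r r-prime r∣n
    m≡st : m ≡ s * t
    m≡st = *-cancelˡ-≡ m (s * t) q (begin
      q * m       ≡⟨ n≡qm ⟨
      n           ≡⟨ n≡rst ⟩
      r * s * t   ≡⟨ *-assoc r s t ⟩
      r * (s * t) ≡⟨ cong (_* (s * t)) (≤-antisym (∣⇒≤ r∣q) q≤r) ⟩
      q * (s * t) ∎)
      where open ≡-Reasoning

module _ {A : Set} where

  Agree : List (A → Bool) → A → A → Set
  Agree tests x y = All (λ f → f x ≡ f y) tests

  length≤filter+filter∁ : {P : Pred A 0ℓ} (P? : Decidable P) (L : List A) →
    length L ≤ length (filter P? L) + length (filter (∁? P?) L)
  length≤filter+filter∁ P? [] = z≤n
  length≤filter+filter∁ P? (x ∷ L) with P? x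
  ... | yes _ = s≤s (length≤filter+filter∁ P? L)
  ... | no _ = ≤-trans (s≤s (length≤filter+filter∁ P? L)) (≤-reflexive (sym (+-suc _ _)))

  -- Halving L according to the first test keeps each half separated by the remaining tests.
  separated⇒length≤2^ : (tests : List (A → Bool)) (L : List A) → Unique L →
    (∀ {x y} → x ∈ₗ L → y ∈ₗ L → Agree tests x y → x ≡ y) → length L ≤ 2 ^ length tests
  separated⇒length≤2^ [] [] _ _ = z≤n
  separated⇒length≤2^ [] (_ ∷ []) _ _ = s≤s z≤n
  separated⇒length≤2^ [] (_ ∷ _ ∷ _) ((x≢y ∷ _) ∷ _) separated =
    ⊥-elim (x≢y (separated (here refl) (there (here refl)) []))
  separated⇒length≤2^ (f ∷ tests) L L-unique separated = begin
    length L                                          ≤⟨ length≤filter+filter∁ T? L ⟩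
    length (filter T? L) + length (filter (∁? T?) L)  ≤⟨ +-mono-≤ (half T? λ fx fy → trans fx (sym fy))
                                                                    (half (∁? T?) λ fx fy → trans (¬-not fx) (sym (¬-not fy))) ⟩
    2 ^ length tests + 2 ^ length tests               ≡⟨ cong (2 ^ length tests +_) (+-identityʳ _) ⟨
    2 ^ length (f ∷ tests)                            ∎
    where
    open ≤-Reasoning
    T? : Decidable (λ x → f x ≡ true)
    T? x = f x Bool.≟ true
    half : {Q : Pred A 0ℓ} (Q? : Decidable Q) → (∀ {x y} → Q x → Q y → f x ≡ f y) →
      length (filter Q? L) ≤ 2 ^ length tests
    half Q? same = separated⇒length≤2^ tests (filter Q? L) (Unique.filter⁺ Q? L-unique) separated-in-half
      where
      separated-in-half : ∀ {x y} → x ∈ₗ filter Q? L → y ∈ₗ filter Q? L → Agree tests x y → x ≡ y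
      separated-in-half x∈ y∈ agree with ∈-filter⁻ Q? x∈ | ∈-filter⁻ Q? y∈
      ... | x∈L , Qx | y∈L , Qy = separated x∈L y∈L (same Qx Qy ∷ agree)

module _ {I : Set} where

  sum-map-mono-≤ : (f g : I → ℕ) (is : List I) → (∀ i → f i ≤ g i) → sum (map f is) ≤ sum (map g is)
  sum-map-mono-≤ f g [] f≤g = z≤n
  sum-map-mono-≤ f g (i ∷ is) f≤g = +-mono-≤ (f≤g i) (sum-map-mono-≤ f g is f≤g)

  sum-map-mono-< : (f g : I → ℕ) {i : I} (is : List I) → i ∈ₗ is →
    (∀ j → f j ≤ g j) → f i < g i → sum (map f is) < sum (map g is)
  sum-map-mono-< f g (_ ∷ is) (here refl) f≤g fi<gi = +-mono-<-≤ fi<gi (sum-map-mono-≤ f g is f≤g)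
  sum-map-mono-< f g (j ∷ is) (there i∈is) f≤g fi<gi = +-mono-≤-< (f≤g j) (sum-map-mono-< f g is i∈is f≤g fi<gi)

  sum-map≤length*bound : (f : I → ℕ) (is : List I) (B : ℕ) → (∀ {i} → i ∈ₗ is → f i ≤ B) →
    sum (map f is) ≤ length is * B
  sum-map≤length*bound f [] B f≤B = z≤n
  sum-map≤length*bound f (i ∷ is) B f≤B = +-mono-≤ (f≤B (here refl)) (sum-map≤length*bound f is B (f≤B ∘ there))

module _ {A I : Set} (P : I → A → Set) (P? : ∀ i → Decidable (P i)) where

  length-filter-∷-mono : ∀ i x L → length (filter (P? i) L) ≤ length (filter (P? i) (x ∷ L))
  length-filter-∷-mono i x L with P? i x
  ... | yes _ = n≤1+n _
  ... | no _ = ≤-refl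

  length-filter-∷-< : ∀ i x L → P i x → length (filter (P? i) L) < length (filter (P? i) (x ∷ L))
  length-filter-∷-< i x L Pix with P? i x
  ... | yes _ = ≤-refl
  ... | no ¬Pix = ⊥-elim (¬Pix Pix)

  length≤sum-length-filter : (is : List I) (L : List A) → (∀ {x} → x ∈ₗ L → ∃ λ i → i ∈ₗ is × P i x) →
    length L ≤ sum (map (λ i → length (filter (P? i) L)) is)
  length≤sum-length-filter is [] _ = z≤n
  length≤sum-length-filter is (x ∷ L) covered with covered (here refl)
  ... | i , i∈is , Pix = begin-strict
    length L                                             ≤⟨ length≤sum-length-filter is L (covered ∘ there) ⟩
    sum (map (λ j → length (filter (P? j) L)) is)        <⟨ sum-map-mono-< _ _ is i∈is (λ j → length-filter-∷-mono j x L)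
                                                                             (length-filter-∷-< i x L Pix) ⟩
    sum (map (λ j → length (filter (P? j) (x ∷ L))) is)  ∎
    where
    open ≤-Reasoning

length-cartesianProduct : ∀ {A B : Set} (xs : List A) (ys : List B) →
  length (cartesianProduct xs ys) ≡ length xs * length ys
length-cartesianProduct [] ys = refl
length-cartesianProduct (x ∷ xs) ys = begin
  length (map (x ,_) ys ++ cartesianProduct xs ys)       ≡⟨ length-++ (map (x ,_) ys) ⟩
  length (map (x ,_) ys) + length (cartesianProduct xs ys) ≡⟨ cong₂ _+_ (length-map (x ,_) ys) (length-cartesianProduct xs ys) ⟩
  length ys + length xs * length ys                      ∎
  where open ≡-Reasoning

-- From a count to the logarithmic bound

-- 2^w ≤ n means w ≤ log₂ n, and T ≤ e/d.
boundLog-intro : ∀ {c e d n} w T → 2 ^ w ≤ n → c ≤ w * w * 2 ^ T → T * d ≤ e → BoundLog c e d n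
boundLog-intro {c} {e} {d} {n} w T 2^w≤n c≤w²2^T Td≤e a b _ a^2d2^e<c^db^2d = begin
  2 ^ a       ≤⟨ ^-monoʳ-≤ 2 (<⇒≤ a<wb) ⟩
  2 ^ (w * b) ≡⟨ ^-*-assoc 2 w b ⟨
  (2 ^ w) ^ b ≤⟨ ^-monoˡ-≤ b 2^w≤n ⟩
  n ^ b       ∎
  where
  open ≤-Reasoning
  power-identity : (w * w * 2 ^ T) ^ d * b ^ (2 * d) ≡ (w * b) ^ (2 * d) * 2 ^ (T * d)
  power-identity = begin-equality
    (w * w * 2 ^ T) ^ d * b ^ (2 * d)      ≡⟨ cong ((w * w * 2 ^ T) ^ d *_) (^-*-assoc b 2 d) ⟨
    (w * w * 2 ^ T) ^ d * (b ^ 2) ^ d      ≡⟨ [m*n]^k≡m^k*n^k (w * w * 2 ^ T) (b ^ 2) d ⟨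
    (w * w * 2 ^ T * b ^ 2) ^ d            ≡⟨ cong (_^ d) (solve 3 (λ w b x → w :* w :* x :* (b :* (b :* con 1))
                                                                     := w :* b :* (w :* b :* con 1) :* x) refl w b (2 ^ T)) ⟩
    ((w * b) ^ 2 * 2 ^ T) ^ d              ≡⟨ [m*n]^k≡m^k*n^k ((w * b) ^ 2) (2 ^ T) d ⟩
    ((w * b) ^ 2) ^ d * (2 ^ T) ^ d        ≡⟨ cong₂ _*_ (^-*-assoc (w * b) 2 d) (^-*-assoc 2 T d) ⟩
    (w * b) ^ (2 * d) * 2 ^ (T * d)        ∎
  c^db^2d≤[wb]^2d2^e : c ^ d * b ^ (2 * d) ≤ (w * b) ^ (2 * d) * 2 ^ e
  c^db^2d≤[wb]^2d2^e = begin
    c ^ d * b ^ (2 * d)               ≤⟨ *-monoˡ-≤ (b ^ (2 * d)) (^-monoˡ-≤ d c≤w²2^T) ⟩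
    (w * w * 2 ^ T) ^ d * b ^ (2 * d) ≡⟨ power-identity ⟩
    (w * b) ^ (2 * d) * 2 ^ (T * d)   ≤⟨ *-monoʳ-≤ ((w * b) ^ (2 * d)) (^-monoʳ-≤ 2 Td≤e) ⟩
    (w * b) ^ (2 * d) * 2 ^ e         ∎
  a<wb : a < w * b
  a<wb = m^k<n^k⇒m<n (2 * d)
    (*-cancelʳ-< (2 ^ e) (a ^ (2 * d)) ((w * b) ^ (2 * d)) (<-≤-trans a^2d2^e<c^db^2d c^db^2d≤[wb]^2d2^e))

-- Key positions

-- For N = r s t, an adapted connection set is determined by its values on
-- 1, …, ⌊st/2⌋ together with the multiples s u of s with t/2 < u ≤ rt/2.
keys : ℕ → ℕ → ℕ → List ℕ
keys r s t = applyUpTo suc ⌊ s * t /2⌋ ++ applyUpTo (λ i → s * (suc ⌊ t /2⌋ + i)) (⌊ r * t /2⌋ ∸ ⌊ t /2⌋)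

keyCount : ℕ → ℕ → ℕ → ℕ
keyCount r s t = ⌊ s * t /2⌋ + (⌊ r * t /2⌋ ∸ ⌊ t /2⌋)

length-keys : ∀ r s t → length (keys r s t) ≡ keyCount r s t
length-keys r s t = trans (length-++ (applyUpTo suc ⌊ s * t /2⌋))
  (cong₂ _+_ (length-applyUpTo suc ⌊ s * t /2⌋) (length-applyUpTo (λ i → s * (suc ⌊ t /2⌋ + i)) (⌊ r * t /2⌋ ∸ ⌊ t /2⌋)))

∈-keys-small : ∀ {r s t k} → 0 < k → k + k ≤ s * t → k ∈ₗ keys r s t
∈-keys-small {k = suc i} _ k+k≤st = ∈-++⁺ˡ (∈-applyUpTo⁺ suc (m+m≤n⇒m≤⌊n/2⌋ k+k≤st))

∈-keys-multiple : ∀ {r s t k} .{{_ : NonZero s}} → 0 < k → s ∣ k → k + k ≤ r * s * t → k ∈ₗ keys r s t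
∈-keys-multiple {r} {s} {t} {k} 0<k s∣k k+k≤rst with k + k ≤? s * t
... | yes k+k≤st = ∈-keys-small {r} {s} {t} 0<k k+k≤st
... | no k+k≰st with s∣k
...   | divides u k≡us = subst (_∈ₗ keys r s t) (trans (cong (s *_) h+1+v≡u) (trans (*-comm s u) (sym k≡us)))
          (∈-++⁺ʳ (applyUpTo suc ⌊ s * t /2⌋) (∈-applyUpTo⁺ (λ i → s * (suc ⌊ t /2⌋ + i)) v<R∸h))
  where
  k+k≡s[u+u] : k + k ≡ s * (u + u)
  k+k≡s[u+u] = trans (cong (λ z → z + z) k≡us) (solve 2 (λ u s → u :* s :+ u :* s := s :* (u :+ u)) refl u s)
  ⌊t/2⌋<u : ⌊ t /2⌋ < u
  ⌊t/2⌋<u = n<m+m⇒⌊n/2⌋<m (*-cancelˡ-< s t (u + u) (subst (s * t <_) k+k≡s[u+u] (≰⇒> k+k≰st)))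
  u≤⌊rt/2⌋ : u ≤ ⌊ r * t /2⌋
  u≤⌊rt/2⌋ = m+m≤n⇒m≤⌊n/2⌋ (*-cancelˡ-≤ s
    (subst₂ _≤_ k+k≡s[u+u] (solve 3 (λ r s t → r :* s :* t := s :* (r :* t)) refl r s t) k+k≤rst))
  v : ℕ
  v = u ∸ suc ⌊ t /2⌋
  h+1+v≡u : suc ⌊ t /2⌋ + v ≡ u
  h+1+v≡u = m+[n∸m]≡n ⌊t/2⌋<u
  v<R∸h : v < ⌊ r * t /2⌋ ∸ ⌊ t /2⌋
  v<R∸h = subst (_≤ ⌊ r * t /2⌋ ∸ ⌊ t /2⌋)
    (trans (cong (_∸ ⌊ t /2⌋) (sym (trans (+-suc ⌊ t /2⌋ v) h+1+v≡u))) (m+n∸m≡n ⌊ t /2⌋ (suc v)))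
    (∸-monoˡ-≤ ⌊ t /2⌋ u≤⌊rt/2⌋)

keyCount-double : ∀ r s t → 1 ≤ r → keyCount r s t + keyCount r s t + t ≤ s * t + r * t + 1
keyCount-double r s t 1≤r = begin
  A + D + (A + D) + t                       ≤⟨ +-monoʳ-≤ (A + D + (A + D)) (n≤1+⌊n/2⌋+⌊n/2⌋ t) ⟩
  A + D + (A + D) + suc (h + h)             ≡⟨ solve 3 (λ A D h → A :+ D :+ (A :+ D) :+ (con 1 :+ (h :+ h))
                                                          := A :+ A :+ ((D :+ h) :+ (D :+ h)) :+ con 1) refl A D h ⟩
  A + A + ((D + h) + (D + h)) + 1           ≡⟨ cong (λ z → A + A + (z + z) + 1) (m∸n+n≡m h≤R) ⟩
  A + A + (R + R) + 1                       ≤⟨ +-monoˡ-≤ 1 (+-mono-≤ (⌊n/2⌋+⌊n/2⌋≤n (s * t)) (⌊n/2⌋+⌊n/2⌋≤n (r * t))) ⟩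
  s * t + r * t + 1                         ∎
  where
  open ≤-Reasoning
  A h R D : ℕ
  A = ⌊ s * t /2⌋
  h = ⌊ t /2⌋
  R = ⌊ r * t /2⌋
  D = R ∸ h
  h≤R : h ≤ R
  h≤R = ⌊n/2⌋-mono (subst (_≤ r * t) (*-identityˡ t) (*-monoˡ-≤ t 1≤r))

-- With r = q+α and s = p+β, multiplying 2K+t ≤ (r+s)t+1 by pq loses exactly t·X.
weighted-bound : ∀ {p q r s t K} → 1 ≤ p → 1 ≤ q → q ≤ r → p ≤ s → K + K + t ≤ s * t + r * t + 1 →
  2 * (p * q) * K ≤ r * s * t * (p + q ∸ 1) + p * q
weighted-bound {suc p'} {suc q'} {r} {s} {t} {K} _ _ q≤r p≤s 2K+t≤ = +-cancelʳ-≤ (P * t) _ _ (begin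
  2 * P * K + P * t                          ≡⟨ solve 3 (λ P K t → con 2 :* P :* K :+ P :* t := P :* (K :+ K :+ t)) refl P K t ⟩
  P * (K + K + t)                            ≤⟨ m≤m+n _ (t * X) ⟩
  P * (K + K + t) + t * X                    ≤⟨ +-monoˡ-≤ (t * X) (*-monoʳ-≤ P 2K+t≤) ⟩
  P * (s * t + r * t + 1) + t * X            ≡⟨ subst₂ (λ r s → P * (s * t + r * t + 1) + t * X ≡ r * s * t * (p' + suc q') + P + P * t)
                                                  (m+[n∸m]≡n q≤r) (m+[n∸m]≡n p≤s) identity ⟩
  r * s * t * (p' + suc q') + P + P * t      ∎)
  where
  open ≤-Reasoning
  P α β X : ℕ
  P = suc p' * suc q'
  α = r ∸ suc q'
  β = s ∸ suc p'
  X = suc q' * β * q' + suc p' * α * p' + α * β * (suc p' + q')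
  identity : P * ((suc p' + β) * t + (suc q' + α) * t + 1) + t * X
           ≡ (suc q' + α) * (suc p' + β) * t * (p' + suc q') + P + P * t
  identity = solve 5 (λ p' q' α β t →
      (con 1 :+ p') :* (con 1 :+ q') :* ((con 1 :+ p' :+ β) :* t :+ (con 1 :+ q' :+ α) :* t :+ con 1)
        :+ t :* ((con 1 :+ q') :* β :* q' :+ (con 1 :+ p') :* α :* p' :+ α :* β :* ((con 1 :+ p') :+ q'))
      := (con 1 :+ q' :+ α) :* (con 1 :+ p' :+ β) :* t :* (p' :+ (con 1 :+ q')) :+ (con 1 :+ p') :* (con 1 :+ q')
           :+ (con 1 :+ p') :* (con 1 :+ q') :* t) refl p' q' α β t

keyCount-weighted : ∀ {p q} r s t → 1 ≤ p → 1 ≤ q → (q ≤ r × p ≤ s) ⊎ (q ≤ s × p ≤ r) →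
  2 * (p * q) * keyCount r s t ≤ r * s * t * (p + q ∸ 1) + p * q
keyCount-weighted r s t 1≤p 1≤q (inj₁ (q≤r , p≤s)) =
  weighted-bound 1≤p 1≤q q≤r p≤s (keyCount-double r s t (≤-trans 1≤q q≤r))
keyCount-weighted {p} {q} r s t 1≤p 1≤q (inj₂ (q≤s , p≤r)) =
  subst (λ x → 2 * (p * q) * keyCount r s t ≤ x * t * (p + q ∸ 1) + p * q) (*-comm s r)
    (weighted-bound 1≤p 1≤q q≤s p≤r
      (subst (λ x → keyCount r s t + keyCount r s t + t ≤ x + 1) (+-comm (s * t) (r * t))
        (keyCount-double r s t (≤-trans 1≤p p≤r))))

-- The cyclic group ℤ_N

module Cyclic (m₀ : ℕ) where

  N : ℕ
  N = suc m₀

  residue : ℕ → Fin N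
  residue a = fromℕ< (m%n<n a N)

  toℕ-residue : ∀ a → toℕ (residue a) ≡ a % N
  toℕ-residue a = toℕ-fromℕ< (m%n<n a N)

  toℕ-residue-< : ∀ {a} → a < N → toℕ (residue a) ≡ a
  toℕ-residue-< {a} a<N = trans (toℕ-residue a) (m<n⇒m%n≡m a<N)

  residue-toℕ : (x : Fin N) → residue (toℕ x) ≡ x
  residue-toℕ x = toℕ-injective (toℕ-residue-< (toℕ<n x))

  residue-cong : ∀ a b → a % N ≡ b % N → residue a ≡ residue b
  residue-cong a b a≡b = toℕ-injective (trans (toℕ-residue a) (trans a≡b (sym (toℕ-residue b))))

  residue-+ : ∀ a b → residue a ⊕ residue b ≡ residue (a + b)
  residue-+ a b = residue-cong (toℕ (residue a) + toℕ (residue b)) (a + b) (begin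
    (toℕ (residue a) + toℕ (residue b)) % N ≡⟨ cong₂ (λ u v → (u + v) % N) (toℕ-residue a) (toℕ-residue b) ⟩
    (a % N + b % N) % N                     ≡⟨ %-distribˡ-+ a b N ⟨
    (a + b) % N                             ∎)
    where open ≡-Reasoning

  residue-+N : ∀ a → residue (a + N) ≡ residue a
  residue-+N a = residue-cong (a + N) a ([m+n]%n≡m%n a N)

  ⊖-residue : ∀ a → a < N → ⊖ (residue a) ≡ residue (N ∸ a)
  ⊖-residue a a<N = cong (λ z → residue (N ∸ z)) (toℕ-residue-< a<N)

  bit : Subset N → ℕ → Bool
  bit S a = lookup S (residue a)

  ∈⇒bit : ∀ {S} a → residue a ∈ S → bit S a ≡ true
  ∈⇒bit a = []=⇒lookup

  bit⇒∈ : ∀ {S} a → bit S a ≡ true → residue a ∈ S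
  bit⇒∈ {S} a = lookup⇒[]= (residue a) S

  module Subgroup {H : Subset N} (H-subgroup : IsSubgroup H) where
    open IsSubgroup H-subgroup

    Contains : ℕ → Set
    Contains a = residue a ∈ H

    contains-0 : Contains 0
    contains-0 = has-zero (residue 0) (toℕ-residue 0)

    contains-+ : ∀ a b → Contains a → Contains b → Contains (a + b)
    contains-+ a b a∈ b∈ = subst (_∈ H) (residue-+ a b) (closed-⊕ _ _ a∈ b∈)

    contains-multiple : ∀ g → Contains g → ∀ j → Contains (j * g)
    contains-multiple g g∈ zero = contains-0
    contains-multiple g g∈ (suc j) = contains-+ g (j * g) g∈ (contains-multiple g g∈ j)

    contains-∸ : ∀ a → a < N → Contains a → Contains (N ∸ a)
    contains-∸ a a<N a∈ = subst (_∈ H) (⊖-residue a a<N) (closed-⊖ _ a∈)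

    ∈⇒contains-toℕ : ∀ {x} → x ∈ H → Contains (toℕ x)
    ∈⇒contains-toℕ {x} x∈H = subst (_∈ H) (sym (residue-toℕ x)) x∈H

    contains-1⇒full : Contains 1 → ∀ x → x ∈ H
    contains-1⇒full 1∈ x =
      subst (_∈ H) (residue-toℕ x) (subst Contains (*-identityʳ (toℕ x)) (contains-multiple 1 1∈ (toℕ x)))

    -- Subtracting ⌊X/g⌋ copies of g from X leaves X mod g, which is a smaller element of H.
    least-positive-divides : ∀ {g} .{{_ : NonZero g}} → g < N → Contains g →
      (∀ j → 0 < j → j < g → ¬ Contains j) → ∀ {X} → X < N → Contains X → g ∣ X
    least-positive-divides {g} g<N g∈ least {X} X<N X∈ with X % g in X%g≡
    ... | zero = m%n≡0⇒n∣m X g X%g≡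
    ... | suc r = ⊥-elim (least (suc r) z<s (subst (_< g) X%g≡ (m%n<n X g)) r∈)
      where
      qg : ℕ
      qg = X / g * g
      qg<N : qg < N
      qg<N = ≤-<-trans (m/n*n≤m X g) X<N
      X+[N∸qg]≡X%g+N : X + (N ∸ qg) ≡ X % g + N
      X+[N∸qg]≡X%g+N = begin
        X + (N ∸ qg)        ≡⟨ +-∸-assoc X (<⇒≤ qg<N) ⟨
        X + N ∸ qg          ≡⟨ cong (λ z → z + N ∸ qg) (m≡m%n+[m/n]*n X g) ⟩
        X % g + qg + N ∸ qg ≡⟨ cong (_∸ qg) (solve 3 (λ x y n → x :+ y :+ n := x :+ n :+ y) refl (X % g) qg N) ⟩
        X % g + N + qg ∸ qg ≡⟨ m+n∸n≡m (X % g + N) qg ⟩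
        X % g + N           ∎
        where open ≡-Reasoning
      r∈ : Contains (suc r)
      r∈ = subst (_∈ H) (residue-+N (suc r))
        (subst Contains (trans X+[N∸qg]≡X%g+N (cong (_+ N) X%g≡))
          (contains-+ X (N ∸ qg) X∈ (contains-∸ qg qg<N (contains-multiple g g∈ (X / g)))))

    PositiveElement : ℕ → Set
    PositiveElement k = 0 < k × Contains k

    trivial-or-generated : (∀ x → x ∈ H → toℕ x ≡ 0) ⊎
      (∃ λ g → 0 < g × g < N × g ∣ N × Contains g × (∀ x → x ∈ H → g ∣ toℕ x))
    trivial-or-generated with least-or-none PositiveElement (λ k → (0 <? k) ×-dec (residue k ∈? H)) N
    ... | inj₁ none = inj₁ λ x x∈H →
      n≤0⇒n≡0 (≮⇒≥ λ 0<x → none (toℕ x) (toℕ<n x) (0<x , ∈⇒contains-toℕ x∈H))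
    ... | inj₂ (g , g<N , (0<g , g∈) , least) =
      inj₂ (g , 0<g , g<N , g∣N , g∈ , λ x x∈H → divides-g (toℕ<n x) (∈⇒contains-toℕ x∈H))
      where
      instance
        g-nonZero : NonZero g
        g-nonZero = >-nonZero 0<g
      divides-g : ∀ {X} → X < N → Contains X → g ∣ X
      divides-g = least-positive-divides g<N g∈ λ j 0<j j<g j∈ → least j j<g (0<j , j∈)
      g∣N : g ∣ N
      g∣N = ∣m∸n∣n⇒∣m g (<⇒≤ g<N) (divides-g (∸-monoʳ-< 0<g (<⇒≤ g<N)) (contains-∸ g g<N g∈)) ∣-refl

    proper⇒multiples-of-prime : (∃ λ x → x ∉ H) → 1 < N →
      ∃ λ s → Prime s × s ∣ N × (∀ x → x ∈ H → s ∣ toℕ x)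
    proper⇒multiples-of-prime (x , x∉H) 1<N with trivial-or-generated
    ... | inj₁ trivial with ∃-prime-divisor N 1<N
    ...   | s , s-prime , s∣N = s , s-prime , s∣N , λ y y∈H → subst (s ∣_) (sym (trivial y y∈H)) (s ∣0)
    proper⇒multiples-of-prime (x , x∉H) 1<N | inj₂ (g , 0<g , _ , g∣N , g∈ , g∣H)
      with ∃-prime-divisor g (≰⇒> λ g≤1 → x∉H (contains-1⇒full (subst Contains (≤-antisym g≤1 0<g) g∈) x))
    ... | s , s-prime , s∣g = s , s-prime , ∣-trans s∣g g∣N , λ y y∈H → ∣-trans s∣g (g∣H y y∈H)

    -- If N = c g with g the generator of H, then H contains all k with N ∣ r k for any prime r ∣ c.
    nontrivial⇒contains-prime-order : (∃ λ x → x ∈ H × toℕ x ≢ 0) →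
      ∃ λ r → Prime r × r ∣ N × (∀ k → N ∣ r * toℕ k → k ∈ H)
    nontrivial⇒contains-prime-order (x , x∈H , x≢0) with trivial-or-generated
    ... | inj₁ trivial = ⊥-elim (x≢0 (trivial x x∈H))
    ... | inj₂ (g , _ , g<N , g∣N , g∈ , _) with ∃-prime-divisor (quotient g∣N) (quotient>1 g∣N g<N)
    ...   | r , r-prime , r∣c = r , r-prime , ∣-trans r∣c (quotient-∣ g∣N) , contains-order-r
      where
      instance
        r-nonZero : NonZero r
        r-nonZero = prime⇒nonZero r-prime
      contains-order-r : ∀ k → N ∣ r * toℕ k → k ∈ H
      contains-order-r k (divides z rk≡zN) =
        subst (_∈ H) (residue-toℕ k) (subst Contains (sym k≡zeg) (contains-multiple g g∈ (z * quotient r∣c)))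
        where
        k≡zeg : toℕ k ≡ z * quotient r∣c * g
        k≡zeg = *-cancelˡ-≡ (toℕ k) (z * quotient r∣c * g) r (begin
          r * toℕ k                   ≡⟨ rk≡zN ⟩
          z * N                       ≡⟨ cong (z *_) (trans (m∣n⇒n≡quotient*m g∣N) (cong (_* g) (m∣n⇒n≡quotient*m r∣c))) ⟩
          z * (quotient r∣c * r * g)  ≡⟨ solve 4 (λ z e r g → z :* (e :* r :* g) := r :* (z :* e :* g)) refl z (quotient r∣c) r g ⟩
          r * (z * quotient r∣c * g)  ∎)
          where open ≡-Reasoning

  CosetClosed : ℕ → ℕ → Subset N → Set
  CosetClosed r s S = ∀ x k → x ∈ S → ¬ s ∣ toℕ x → N ∣ r * toℕ k → (x ⊕ k) ∈ S

  -- The pair (r , s) records primes with K ⊇ (N/r)ℤ_N and H ⊆ sℤ_N.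
  Adapted : ℕ × ℕ → Subset N → Set
  Adapted (r , s) S = r * s ∣ N × IsConnectionSet S × CosetClosed r s S

  isConnectionSet? : (S : Subset N) → Dec (IsConnectionSet S)
  isConnectionSet? S =
    map′ (λ (z , y) → record { no-zero = z ; symmetric = y })
         (λ c → IsConnectionSet.no-zero c , IsConnectionSet.symmetric c)
         (all? (λ x → (toℕ x ≟ 0) →-dec ¬? (x ∈? S)) ×-dec all? (λ x → (x ∈? S) →-dec ((⊖ x) ∈? S)))

  adapted? : ∀ rs S → Dec (Adapted rs S)
  adapted? (r , s) S = (r * s ∣? N) ×-dec isConnectionSet? S ×-dec
    all? (λ x → all? (λ k → (x ∈? S) →-dec (¬? (s ∣? toℕ x) →-dec ((N ∣? r * toℕ k) →-dec ((x ⊕ k) ∈? S)))))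

  gwc⇒adapted : ∀ {S} → 1 < N → IsGenWreathCirculant S → ∃₂ λ r s → Prime r × Prime s × Adapted (r , s) S
  gwc⇒adapted {S} 1<N (S-connection , K , H , witness)
    with Subgroup.nontrivial⇒contains-prime-order (GWWitness.K-subgroup witness) (GWWitness.K-nontrivial witness)
       | Subgroup.proper⇒multiples-of-prime (GWWitness.H-subgroup witness) (GWWitness.H-proper witness) 1<N
  ... | r , r-prime , r∣N , K⊇order-r | s , s-prime , _ , H⊆sℤ =
    r , s , r-prime , s-prime , r*s∣N , S-connection ,
    λ x k x∈S s∤x N∣rk → proj₁ (cosets x k x∈S (λ x∈H → s∤x (H⊆sℤ x x∈H)) (K⊇order-r k N∣rk))
    where
    open GWWitness witness
    c : ℕ
    c = quotient r∣N
    N≡rc : N ≡ r * c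
    N≡rc = m∣n⇒n≡m*quotient r∣N
    c<N : c < N
    c<N = subst (c <_) (trans (*-comm c r) (sym N≡rc)) (m<m*n c r {{m*n≢0⇒n≢0 r {{subst NonZero N≡rc _}}}} (prime⇒1< r-prime))
    -- The residue of c = N/r has order r, so it lies in K ≤ H and therefore s ∣ c.
    s∣c : s ∣ c
    s∣c = subst (s ∣_) (toℕ-residue-< c<N)
      (H⊆sℤ (residue c) (K≤H (residue c) (K⊇order-r (residue c)
        (subst (N ∣_) (trans N≡rc (cong (r *_) (sym (toℕ-residue-< c<N)))) ∣-refl))))
    r*s∣N : r * s ∣ N
    r*s∣N = subst (r * s ∣_) (sym N≡rc) (*-monoʳ-∣ r s∣c)

  module _ {S : Subset N} (S-connection : IsConnectionSet S) where
    open IsConnectionSet S-connection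

    bit-0 : bit S 0 ≡ false
    bit-0 = ¬-not (λ bit≡true → no-zero (residue 0) (toℕ-residue 0) (bit⇒∈ 0 bit≡true))

    bit-⊖ : ∀ {y} → 0 < y → y < N → bit S y ≡ bit S (N ∸ y)
    bit-⊖ {y} 0<y y<N = ⇔→≡ (mk⇔
      (λ y∈ → ∈⇒bit (N ∸ y) (subst (_∈ S) (⊖-residue y y<N) (symmetric _ (bit⇒∈ y y∈))))
      (λ N∸y∈ → ∈⇒bit y (subst (_∈ S) (trans (⊖-residue (N ∸ y) N∸y<N) (cong residue (m∸[m∸n]≡n (<⇒≤ y<N))))
                                      (symmetric _ (bit⇒∈ (N ∸ y) N∸y∈)))))
      where
      N∸y<N : N ∸ y < N
      N∸y<N = ∸-monoʳ-< 0<y (<⇒≤ y<N)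

  coset-closed-shift : ∀ {r s S} → CosetClosed r s S → s ∣ N → ∀ {y k} → k < N →
    residue y ∈ S → ¬ s ∣ y → N ∣ r * k → residue (y + k) ∈ S
  coset-closed-shift {r} {s} {S} closed s∣N {y} {k} k<N y∈S s∤y N∣rk =
    subst (_∈ S) (residue-+ y k)
      (closed (residue y) (residue k) y∈S
        (λ s∣y%N → s∤y (∣n∣m%n⇒∣m s∣N (subst (s ∣_) (toℕ-residue y) s∣y%N)))
        (subst (λ z → N ∣ r * z) (sym (toℕ-residue-< k<N)) N∣rk))

  module Determination (r s t : ℕ) (N≡rst : N ≡ r * s * t) where

    private
      a : ℕ
      a = s * t

    N≡ra : N ≡ r * a
    N≡ra = trans N≡rst (*-assoc r s t)

    private
      ra-nonZero : NonZero (r * a)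
      ra-nonZero = subst NonZero N≡ra _

    instance
      r-nonZero : NonZero r
      r-nonZero = m*n≢0⇒m≢0 r {{ra-nonZero}}
      a-nonZero : NonZero a
      a-nonZero = m*n≢0⇒n≢0 r {{ra-nonZero}}
      s-nonZero : NonZero s
      s-nonZero = m*n≢0⇒m≢0 s {{a-nonZero}}

    s∣a : s ∣ a
    s∣a = m∣m*n t

    s∣N : s ∣ N
    s∣N = subst (s ∣_) (sym N≡ra) (∣n⇒∣m*n r s∣a)

    N≡a+[r-1]a : N ≡ a + pred r * a
    N≡a+[r-1]a = trans N≡ra (cong (_* a) (sym (suc-pred r)))

    SameBit : ℕ → ℕ → Set
    SameBit y k = ∀ {S} → IsConnectionSet S → CosetClosed r s S → bit S y ≡ bit S k

    -- Shifting by a multiple of a = N/r stays in the subgroup of order r.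
    bit-shift : ∀ {y} j → j * a < N → ¬ s ∣ y → SameBit y (y + j * a)
    bit-shift {y} zero _ _ {S} _ _ = cong (bit S) (sym (+-identityʳ y))
    bit-shift {y} j@(suc _) ja<N s∤y {S} _ closed = ⇔→≡ (mk⇔
      (λ y∈ → ∈⇒bit (y + j * a) (coset-closed-shift {r} {s} {S} closed s∣N ja<N (bit⇒∈ y y∈) s∤y N∣r[ja]))
      (λ y+ja∈ → ∈⇒bit y (subst (_∈ S) back
        (coset-closed-shift {r} {s} {S} closed s∣N N∸ja<N (bit⇒∈ (y + j * a) y+ja∈) s∤y+ja N∣r[N∸ja]))))
      where
      N∣r[ja] : N ∣ r * (j * a)
      N∣r[ja] = divides j (trans (solve 3 (λ r j a → r :* (j :* a) := j :* (r :* a)) refl r j a) (cong (j *_) (sym N≡ra)))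
      N∸ja<N : N ∸ j * a < N
      N∸ja<N = ∸-monoʳ-< (<-≤-trans (>-nonZero⁻¹ a) (m≤m+n a _)) (<⇒≤ ja<N)
      N∣r[N∸ja] : N ∣ r * (N ∸ j * a)
      N∣r[N∸ja] = subst (N ∣_) (sym (*-distribˡ-∸ r N (j * a))) (∣m∣n⇒∣m∸n (n∣m*n r) N∣r[ja])
      s∤y+ja : ¬ s ∣ y + j * a
      s∤y+ja s∣y+ja = s∤y (∣m+n∣m⇒∣n (subst (s ∣_) (+-comm y (j * a)) s∣y+ja) (∣n⇒∣m*n j s∣a))
      back : residue (y + j * a + (N ∸ j * a)) ≡ residue y
      back = trans (cong residue (trans (+-assoc y (j * a) _) (cong (y +_) (m+[n∸m]≡n (<⇒≤ ja<N))))) (residue-+N y)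

    -- Reflect y ∈ (a/2, a) to a − y, passing through N − y = (a − y) + (r−1)a.
    below-a-reduces : ∀ {y} → 0 < y → y < a → ¬ s ∣ y → ∃ λ k → k ∈ₗ keys r s t × SameBit y k
    below-a-reduces {y} 0<y y<a s∤y with y + y ≤? a
    ... | yes y+y≤a = y , ∈-keys-small {r} {s} {t} 0<y y+y≤a , λ _ _ → refl
    ... | no y+y≰a = a ∸ y ,
      ∈-keys-small {r} {s} {t} (m<n⇒0<n∸m y<a) (m≤n+n⇒[m∸n]+[m∸n]≤m (<⇒≤ (≰⇒> y+y≰a)) (<⇒≤ y<a)) ,
      λ {S} connection closed → begin
        bit S y                         ≡⟨ bit-⊖ connection 0<y y<N ⟩
        bit S (N ∸ y)                   ≡⟨ cong (bit S) N∸y≡[a∸y]+[r-1]a ⟩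
        bit S (a ∸ y + pred r * a)      ≡⟨ bit-shift (pred r) [r-1]a<N s∤a∸y {S} connection closed ⟨
        bit S (a ∸ y)                   ∎
      where
      open ≡-Reasoning
      y<N : y < N
      y<N = <-≤-trans y<a (subst (a ≤_) (sym N≡a+[r-1]a) (m≤m+n a _))
      N∸y≡[a∸y]+[r-1]a : N ∸ y ≡ a ∸ y + pred r * a
      N∸y≡[a∸y]+[r-1]a = trans (cong (_∸ y) N≡a+[r-1]a) (+-∸-comm (pred r * a) (<⇒≤ y<a))
      [r-1]a<N : pred r * a < N
      [r-1]a<N = subst (pred r * a <_) (sym N≡a+[r-1]a) (m<n+m (pred r * a) (>-nonZero⁻¹ a))
      s∤a∸y : ¬ s ∣ a ∸ y
      s∤a∸y s∣a∸y = s∤y (subst (s ∣_) (m∸[m∸n]≡n (<⇒≤ y<a)) (∣m∣n⇒∣m∸n s∣a s∣a∸y))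

    nondivisible-reduces : ∀ {y} → y < N → ¬ s ∣ y → ∃ λ k → k ∈ₗ keys r s t × SameBit y k
    nondivisible-reduces {y} y<N s∤y =
      let k , k∈keys , same = below-a-reduces 0<y%a (m%n<n y a) s∤y%a
      in k , k∈keys , λ {S} connection closed → begin
        bit S y                     ≡⟨ cong (bit S) y≡y%a+[y/a]a ⟩
        bit S (y % a + y / a * a)   ≡⟨ bit-shift (y / a) (≤-<-trans (m/n*n≤m y a) y<N) s∤y%a {S} connection closed ⟨
        bit S (y % a)               ≡⟨ same connection closed ⟩
        bit S k                     ∎
      where
      open ≡-Reasoning
      y≡y%a+[y/a]a : y ≡ y % a + y / a * a
      y≡y%a+[y/a]a = m≡m%n+[m/n]*n y a
      s∤y%a : ¬ s ∣ y % a
      s∤y%a s∣y%a = s∤y (subst (s ∣_) (sym y≡y%a+[y/a]a) (∣m∣n⇒∣m+n s∣y%a (∣n⇒∣m*n (y / a) s∣a)))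
      0<y%a : 0 < y % a
      0<y%a = n≢0⇒n>0 λ y%a≡0 → s∤y%a (subst (s ∣_) (sym y%a≡0) (s ∣0))

    reduces-to-key : ∀ {y} → y < N → y ≡ 0 ⊎ ∃ λ k → k ∈ₗ keys r s t × SameBit y k
    reduces-to-key {y} y<N with y ≟ 0 | s ∣? y
    ... | yes y≡0 | _ = inj₁ y≡0
    ... | no _ | no s∤y = inj₂ (nondivisible-reduces y<N s∤y)
    ... | no y≢0 | yes s∣y with y + y ≤? N
    ...   | yes y+y≤N = inj₂ (y , ∈-keys-multiple {r} {s} {t} (n≢0⇒n>0 y≢0) s∣y (subst (y + y ≤_) N≡rst y+y≤N) , λ _ _ → refl)
    ...   | no y+y≰N = inj₂ (N ∸ y ,
      ∈-keys-multiple {r} {s} {t} (m<n⇒0<n∸m y<N) (∣m∣n⇒∣m∸n s∣N s∣y)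
        (subst (N ∸ y + (N ∸ y) ≤_) N≡rst (m≤n+n⇒[m∸n]+[m∸n]≤m (<⇒≤ (≰⇒> y+y≰N)) (<⇒≤ y<N))) ,
      λ connection _ → bit-⊖ connection (n≢0⇒n>0 y≢0) y<N)

    determined-by-keys : ∀ {S S'} → IsConnectionSet S → CosetClosed r s S → IsConnectionSet S' → CosetClosed r s S' →
      All (λ k → bit S k ≡ bit S' k) (keys r s t) → S ≡ S'
    determined-by-keys {S} {S'} S-connection S-closed S'-connection S'-closed agree =
      trans (sym (tabulate∘lookup S)) (trans (tabulate-cong same-everywhere) (tabulate∘lookup S'))
      where
      same-everywhere : ∀ x → lookup S x ≡ lookup S' x
      same-everywhere x with reduces-to-key (toℕ<n x)
      ... | inj₁ x≡0 = begin
        lookup S x       ≡⟨ cong (lookup S) (residue-toℕ x) ⟨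
        bit S (toℕ x)    ≡⟨ cong (bit S) x≡0 ⟩
        bit S 0          ≡⟨ trans (bit-0 S-connection) (sym (bit-0 S'-connection)) ⟩
        bit S' 0         ≡⟨ cong (bit S') x≡0 ⟨
        bit S' (toℕ x)   ≡⟨ cong (lookup S') (residue-toℕ x) ⟩
        lookup S' x      ∎
        where open ≡-Reasoning
      ... | inj₂ (k , k∈keys , same) = begin
        lookup S x       ≡⟨ cong (lookup S) (residue-toℕ x) ⟨
        bit S (toℕ x)    ≡⟨ same S-connection S-closed ⟩
        bit S k          ≡⟨ All.lookup agree k∈keys ⟩
        bit S' k         ≡⟨ same S'-connection S'-closed ⟨
        bit S' (toℕ x)   ≡⟨ cong (lookup S') (residue-toℕ x) ⟩
        lookup S' x      ∎
        where open ≡-Reasoning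

  primeFactors : List ℕ
  primeFactors = PrimeFactorisation.factors (factorise N)

  2^|primeFactors|≤N : 2 ^ length primeFactors ≤ N
  2^|primeFactors|≤N = subst (2 ^ length primeFactors ≤_) (sym (PrimeFactorisation.isFactorisation (factorise N)))
    (2^length≤product primeFactors (PrimeFactorisation.factorsPrime (factorise N)))

  ∈-primeFactors : ∀ {r} → Prime r → r ∣ N → r ∈ₗ primeFactors
  ∈-primeFactors r-prime r∣N = factorisationHasAllPrimeFactors r-prime
    (subst (_ ∣_) (PrimeFactorisation.isFactorisation (factorise N)) r∣N) (PrimeFactorisation.factorsPrime (factorise N))

  adapted-count : ∀ {r s B} (L : List (Subset N)) → Unique L →
    (∀ t → N ≡ r * s * t → keyCount r s t ≤ B) → length (filter (adapted? (r , s)) L) ≤ 2 ^ B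
  adapted-count {r} {s} {B} L L-unique keyCount≤B = by-divisibility (r * s ∣? N)
    where
    by-divisibility : Dec (r * s ∣ N) → length (filter (adapted? (r , s)) L) ≤ 2 ^ B
    by-divisibility (no r*s∤N) = subst (λ xs → length xs ≤ 2 ^ B)
      (sym (filter-none (adapted? (r , s)) {L} (All.tabulate λ _ adapted → r*s∤N (proj₁ adapted)))) z≤n
    by-divisibility (yes (divides t N≡t*rs)) = begin
      length (filter (adapted? (r , s)) L) ≤⟨ separated⇒length≤2^ tests _ (Unique.filter⁺ (adapted? (r , s)) L-unique) separated ⟩
      2 ^ length tests                     ≡⟨ cong (2 ^_) (trans (length-map _ (keys r s t)) (length-keys r s t)) ⟩
      2 ^ keyCount r s t                   ≤⟨ ^-monoʳ-≤ 2 (keyCount≤B t N≡rst) ⟩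
      2 ^ B                                ∎
      where
      open ≤-Reasoning
      N≡rst : N ≡ r * s * t
      N≡rst = trans N≡t*rs (*-comm t (r * s))
      tests : List (Subset N → Bool)
      tests = map (λ k S → bit S k) (keys r s t)
      separated : ∀ {S S'} → S ∈ₗ filter (adapted? (r , s)) L → S' ∈ₗ filter (adapted? (r , s)) L →
        Agree tests S S' → S ≡ S'
      separated S∈ S'∈ agree with ∈-filter⁻ (adapted? (r , s)) {xs = L} S∈ | ∈-filter⁻ (adapted? (r , s)) {xs = L} S'∈
      ... | _ , _ , S-connection , S-closed | _ , _ , S'-connection , S'-closed =
        Determination.determined-by-keys r s t N≡rst S-connection S-closed S'-connection S'-closed (AllP.map⁻ agree)

  gwc-count : ∀ {B} (L : List (Subset N)) → Unique L → All IsGenWreathCirculant L → 1 < N →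
    (∀ r s t → Prime r → Prime s → N ≡ r * s * t → keyCount r s t ≤ B) →
    length L ≤ length primeFactors * length primeFactors * 2 ^ B
  gwc-count {B} L L-unique L-gwc 1<N keyCount≤B = begin
    length L                                                     ≤⟨ length≤sum-length-filter Adapted adapted? pairs L covered ⟩
    sum (map (λ rs → length (filter (adapted? rs) L)) pairs)     ≤⟨ sum-map≤length*bound _ pairs (2 ^ B) each-class ⟩
    length pairs * 2 ^ B                                         ≡⟨ cong (_* 2 ^ B) (length-cartesianProduct primeFactors primeFactors) ⟩
    length primeFactors * length primeFactors * 2 ^ B            ∎
    where
    open ≤-Reasoning
    pairs : List (ℕ × ℕ)
    pairs = cartesianProduct primeFactors primeFactors
    covered : ∀ {S} → S ∈ₗ L → ∃ λ rs → rs ∈ₗ pairs × Adapted rs S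
    covered S∈L with gwc⇒adapted 1<N (All.lookup L-gwc S∈L)
    ... | r , s , r-prime , s-prime , adapted@(r*s∣N , _) =
      (r , s) , ∈-cartesianProduct⁺ (∈-primeFactors r-prime (m*n∣⇒m∣ r s r*s∣N)) (∈-primeFactors s-prime (m*n∣⇒n∣ r s r*s∣N)) , adapted
    each-class : ∀ {rs} → rs ∈ₗ pairs → length (filter (adapted? rs) L) ≤ 2 ^ B
    each-class {r , s} rs∈pairs = adapted-count {r} {s} L L-unique λ t → keyCount≤B r s t (prime r∈) (prime s∈)
      where
      prime : ∀ {p} → p ∈ₗ primeFactors → Prime p
      prime = All.lookup (PrimeFactorisation.factorsPrime (factorise N))
      r∈ : r ∈ₗ primeFactors
      r∈ = proj₁ (∈-cartesianProduct⁻ primeFactors primeFactors rs∈pairs)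
      s∈ : s ∈ₗ primeFactors
      s∈ = proj₂ (∈-cartesianProduct⁻ primeFactors primeFactors rs∈pairs)

  gwc-boundLog : (L : List (Subset N)) → Unique L → All IsGenWreathCirculant L → 1 < N →
    ∀ d e → 0 < d → (∀ r s t → Prime r → Prime s → N ≡ r * s * t → d * keyCount r s t ≤ e) →
    BoundLog (length L) e d N
  gwc-boundLog L L-unique L-gwc 1<N d e 0<d d*keyCount≤e =
    boundLog-intro (length primeFactors) (e / d) 2^|primeFactors|≤N
      (gwc-count L L-unique L-gwc 1<N λ r s t r-prime s-prime N≡rst →
        m*n≤o⇒m≤o/n (keyCount r s t) d e (subst (_≤ e) (*-comm d _) (d*keyCount≤e r s t r-prime s-prime N≡rst)))
      (m/n*n≤m e d)
    where
    instance
      d-nonZero : NonZero d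
      d-nonZero = >-nonZero 0<d

corollary2p14 : (n q m p : ℕ) → Composite n →
  Prime q → n ≡ q * m → ((r : ℕ) → Prime r → r ∣ n → q ≤ r) →
  Prime p → p ∣ m → ((r : ℕ) → Prime r → r ∣ m → p ≤ r) →
  (L : List (Subset n)) → Unique L → All IsGenWreathCirculant L →
  BoundLog (length L) (n * (p + q ∸ 1) + p * q) (2 * (p * q)) n
    × BoundLog (length L) (3 * n + 4) 8 n
corollary2p14 zero _ _ _ n-composite = ⊥-elim (¬composite[0] n-composite)
corollary2p14 n@(suc m₀) q m p n-composite q-prime n≡qm q-least p-prime _ p-least L L-unique L-gwc =
    gwc-boundLog L L-unique L-gwc 1<n (2 * (p * q)) _ (*-mono-≤ {1} {2} (s≤s z≤n) (*-mono-≤ 1≤p 1≤q))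
      (λ r s t r-prime s-prime n≡rst →
        subst (λ x → 2 * (p * q) * keyCount r s t ≤ x * (p + q ∸ 1) + p * q) (sym n≡rst)
          (keyCount-weighted r s t 1≤p 1≤q
            (least-prime-factors-dominate q-prime n≡qm q-least p-least r-prime s-prime n≡rst)))
  , gwc-boundLog L L-unique L-gwc 1<n 8 _ z<s
      λ r s t r-prime s-prime n≡rst →
        subst (λ x → 8 * keyCount r s t ≤ x) (trans (cong (λ x → x * 3 + 4) (sym n≡rst)) (cong (_+ 4) (*-comm n 3)))
          (keyCount-weighted r s t (s≤s z≤n) (s≤s z≤n) (inj₁ (prime⇒1< r-prime , prime⇒1< s-prime)))
  where
  open Cyclic m₀
  1<n : 1 < n
  1<n = nonTrivial⇒n>1 n {{composite⇒nonTrivial n-composite}}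
  1≤p : 1 ≤ p
  1≤p = <⇒≤ (prime⇒1< p-prime)
  1≤q : 1 ≤ q
  1≤q = <⇒≤ (prime⇒1< q-prime)
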